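{- Let $n\ge 6$ and $1\le k\le \lfloor n/2\rfloor$, and use the conventions $r_0(n)=2$ and $r_{\lfloor n/2\rfloor}(n)=1$. Then for every $r\in(r_k(n),r_{k-1}(n))$ the $k$-isolated cut has maximum weight among all isolated cuts: $W^n(C_k;r)\ge W^n(C_j;r)$ for all $j=1,\dots,\lfloor n/2\rfloor$.
   Context: For an integer $n\ge 2$ let $N=\binom{n}{2}$. The edges $(i,j)$, $1\le i<j\le n$, of the complete graph $K_n$ on vertex set $\{1,\dots,n\}$ are ordered lexicographically: $(1,2),(1,3),\dots,(1,n),(2,3),\dots,(n-1,n)$, so that $(i,j)$ has index $\mathrm{idx}(i,j)=(i-1)n-\binom{i}{2}+(j-i)\in\{1,\dots,N\}$. For a binary string $\mathbf{x}=(x_1,\dots,x_n)$, its cut vector $\delta(\mathbf{x})\in\{0,1\}^N$ has entry $1$ at position $\mathrm{idx}(i,j)$ iff $x_i\ne x_j$. For real $r>1$ and $\delta\in\{0,1\}^N$ set $W^n(\delta;r)=\sum_{i=1}^N \delta_i r^{N-i}$. For $1\le k\le n$, the $k$-isolated cut is $C_k=\delta(1^k0^{n-k})$ (the string of $k$ ones followed by $n-k$ zeros), corresponding to the partition $\{1,\dots,k\}\mid\{k+1,\dots,n\}$; the "isolated cuts" are the $C_j$. For $1\le k\le n-1$ define the threshold polynomial $P^{n,k}(r)=W^n(C_k;r)-W^n(C_{k+1};r)$. For $n\ge 6$ and $1\le k\le\lfloor n/2\rfloor-1$, $P^{n,k}$ has exactly one root in $(1,2)$; this root is denoted $r_k(n)$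 (the threshold at which $C_k$ and $C_{k+1}$ have equal weight). -}

module Defs where

open import Level using (0ℓ)
open import Data.Nat as ℕ using (ℕ; zero; suc; _∸_; _<ᵇ_; _/_)
open import Data.Fin using (Fin; toℕ; _<?_)
open import Data.Bool using (Bool; true; false; not; _xor_)
open import Data.List using (List; []; _∷_; map; concatMap; filter; length)
open import Data.List.Base using (allFin)
open import Data.Product using (_×_; _,_; ∃)
open import Data.Sum using (_⊎_)
open import Relation.Nullary using (¬_)
open import Relation.Binary.PropositionalEquality using (_≡_)
open import Relation.Binary.Structures using (IsStrictTotalOrder)
open import Algebra.Structures using (IsCommutativeRing)

-- The real numbers, axiomatised as a Dedekind-complete ordered field
-- (stdlib has no reals; any such structure is classically ≅ ℝ).

record RealField : Set₁ where
  infixl 6 _+_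
  infixl 7 _*_
  infix  4 _<_ _≤_
  field
    Carrier : Set
    _+_ _*_ : Carrier → Carrier → Carrier
    -_      : Carrier → Carrier
    0# 1#   : Carrier
    _<_     : Carrier → Carrier → Set
    isCommutativeRing : IsCommutativeRing _≡_ _+_ _*_ -_ 0# 1#
    isStrictTotalOrder : IsStrictTotalOrder _≡_ _<_
    inverse : ∀ x → ¬ (x ≡ 0#) → ∃ λ y → x * y ≡ 1#
    +-mono-< : ∀ {x y} z → x < y → x + z < y + z
    *-pos    : ∀ {x y} → 0# < x → 0# < y → 0# < x * y

  _≤_ : Carrier → Carrier → Set
  x ≤ y = x < y ⊎ x ≡ y

  field
    complete : (S : Carrier → Set) → ∃ S → (∃ λ b → ∀ x → S x → x ≤ b) →
               ∃ λ s → (∀ x → S x → x ≤ s) × (∀ b → (∀ x → S x → x ≤ b) → s ≤ b)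

  fromℕ : ℕ → Carrier
  fromℕ zero    = 0#
  fromℕ (suc m) = fromℕ m + 1#

  _^_ : Carrier → ℕ → Carrier
  x ^ zero  = 1#
  x ^ suc m = x * (x ^ m)

edges : (n : ℕ) → List (Fin n × Fin n)
edges n = concatMap (λ i → map (λ j → (i , j)) (filter (i <?_) (allFin n))) (allFin n)

cutVector : {n : ℕ} → (Fin n → Bool) → List Bool
cutVector {n} x = map (λ e → x (Data.Product.proj₁ e) xor x (Data.Product.proj₂ e)) (edges n)

onesThenZeros : (n k : ℕ) → Fin n → Bool
onesThenZeros n k i = toℕ i <ᵇ k

isolatedCut : (n k : ℕ) → List Bool
isolatedCut n k = cutVector (onesThenZeros n k)

module _ (ℝ : RealField) where
  open RealField ℝ

  bit : Bool → Carrier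
  bit true  = 1#
  bit false = 0#

  -- W^n(δ; r) = Σ_{i=1}^{N} δ_i r^{N-i}, with N = length δ
  -- (= n choose 2 for cut vectors); the entry δ_i is followed by N - i entries.
  W : List Bool → Carrier → Carrier
  W []       r = 0#
  W (b ∷ bs) r = bit b * (r ^ length bs) + W bs r

  P : (n k : ℕ) → Carrier → Carrier
  P n k r = W (isolatedCut n k) r + (- W (isolatedCut n (suc k)) r)

  -- ρ is the threshold r_k(n):  for 1 ≤ k ≤ ⌊n/2⌋-1 the (unique) root of
  -- P^{n,k} in (1,2); conventions r_0(n) = 2 and r_{⌊n/2⌋}(n) = 1.
  IsThreshold : (n k : ℕ) → Carrier → Set
  IsThreshold n zero ρ = ρ ≡ 1# + 1#
  IsThreshold n (suc k) ρ with suc k ℕ.≟ n / 2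
  ... | Relation.Nullary.yes _ = ρ ≡ 1#
  ... | Relation.Nullary.no  _ = (P n (suc k) ρ ≡ 0#) × (1# < ρ) × (ρ < 1# + 1#)

-- Write w k r = W (isolatedCut n k) r. Splitting the cut vector of C_k row by row gives
-- w k = (Σ_{i<k} r ^ choose2 (n-1-i)) · (1 + r + … + r ^ (n-k-1)), and hence, with a = n-k-1,
-- P^{n,k} = P⁺ - P⁻ where P⁺ = r ^ a · Σ_{i<k} r ^ choose2 (n-1-i) and
-- P⁻ = r ^ choose2 a · (1 + … + r ^ (a-1)).
-- Every monomial of P⁺ has degree at least M = choose2 (a+1) and every monomial of P⁻ has degree
-- below M, so P⁺ / r ^ M is nondecreasing and P⁻ / r ^ M is decreasing on r > 0: P^{n,k} is negative
-- left of its root r_k(n) and positive right of it. Moreover, for r > 1 the same factorisation shows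
-- that w (k+1) ≤ w k forces w (k+2) < w (k+1), so k ↦ w k is unimodal. For r_k(n) < r < r_{k-1}(n)
-- we have w (k+1) < w k and w (k-1) < w k, so w k is the largest of w 1, …, w ⌊n/2⌋.

module Submission where

open import Defs
open import Level using (0ℓ; _⊔_)
open import Algebra.Bundles using (CommutativeRing)
open import Algebra.Structures using (IsCommutativeRing)
open import Data.Bool using (Bool; true; false; not; _xor_)
open import Data.Empty using (⊥-elim)
open import Data.Fin using (Fin; zero; suc; toℕ; _<?_)
open import Data.List using (List; []; _∷_; _++_; map; filter; length; tabulate; allFin; concatMap)
open import Data.List.Properties
  using (map-++; map-∘; map-tabulate; length-map; length-++; length-tabulate;
         concatMap-map; map-concatMap; concatMap-cong)
open import Data.Nat as ℕ using (ℕ; zero; suc; _∸_; _/_; _<ᵇ_; _≤′_; ≤′-refl; ≤′-step; z≤n; s≤s)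
import Data.Nat.Properties as ℕ
open import Data.Nat.DivMod using (m/n<m)
open import Data.Product as Product using (_×_; _,_; proj₁; proj₂)
open import Data.Sum using (inj₁; inj₂; [_,_]′)
open import Function using (_∘_; id; case_of_)
open import Relation.Nullary using (¬_; does; yes; no)
open import Relation.Binary.Bundles using (StrictTotalOrder)
open import Relation.Binary.Definitions using (tri<; tri≈; tri>)
open import Relation.Binary.PropositionalEquality

choose2 : ℕ → ℕ
choose2 zero    = zero
choose2 (suc n) = n ℕ.+ choose2 n

choose2-mono : ∀ {m n} → m ℕ.≤ n → choose2 m ℕ.≤ choose2 n
choose2-mono {zero}          _         = z≤n
choose2-mono {suc m} {suc n} (s≤s m≤n) = ℕ.+-mono-≤ m≤n (choose2-mono m≤n)

m∸n≡1+[m∸1+n] : ∀ {m n} → n ℕ.< m → m ∸ n ≡ suc (m ∸ suc n)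
m∸n≡1+[m∸1+n] {suc m} (s≤s n≤m) = ℕ.+-∸-assoc 1 n≤m

m≤n/2⇒m<n : ∀ {m n} → 0 ℕ.< m → m ℕ.≤ n / 2 → m ℕ.< n
m≤n/2⇒m<n {n = zero}  0<m m≤0   = ⊥-elim (ℕ.<-irrefl refl (ℕ.<-≤-trans 0<m m≤0))
m≤n/2⇒m<n {n = suc n} _   m≤n/2 = ℕ.≤-<-trans m≤n/2 (m/n<m (suc n) 2 (s≤s (s≤s z≤n)))

allFin-suc : ∀ n → allFin (suc n) ≡ zero ∷ map suc (allFin n)
allFin-suc n = cong (zero {n} ∷_) (sym (map-tabulate id suc))

filter-zero<-map-suc : ∀ {n} (xs : List (Fin n)) → filter (zero {n} <?_) (map suc xs) ≡ map suc xs
filter-zero<-map-suc []       = refl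
filter-zero<-map-suc (x ∷ xs) = cong (suc x ∷_) (filter-zero<-map-suc xs)

filter-suc<-map-suc : ∀ {n} (i : Fin n) (xs : List (Fin n)) →
  filter (suc i <?_) (map suc xs) ≡ map suc (filter (i <?_) xs)
filter-suc<-map-suc i []       = refl
filter-suc<-map-suc i (x ∷ xs) with does (i <? x)
... | true  = cong (suc x ∷_) (filter-suc<-map-suc i xs)
... | false = filter-suc<-map-suc i xs

row : ∀ n → Fin n → List (Fin n × Fin n)
row n i = map (i ,_) (filter (i <?_) (allFin n))

row-zero : ∀ n → row (suc n) zero ≡ map (λ j → zero , suc j) (allFin n)
row-zero n = begin
  map (zero ,_) (filter (zero {n} <?_) (allFin (suc n)))
    ≡⟨ cong (map (zero ,_) ∘ filter (zero {n} <?_)) (allFin-suc n) ⟩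
  map (zero ,_) (filter (zero {n} <?_) (map suc (allFin n)))
    ≡⟨ cong (map (zero ,_)) (filter-zero<-map-suc (allFin n)) ⟩
  map (zero ,_) (map suc (allFin n))
    ≡⟨ map-∘ (allFin n) ⟨
  map (λ j → zero , suc j) (allFin n) ∎
  where open ≡-Reasoning

row-suc : ∀ n (i : Fin n) → row (suc n) (suc i) ≡ map (Product.map suc suc) (row n i)
row-suc n i = begin
  map (suc i ,_) (filter (suc i <?_) (allFin (suc n)))
    ≡⟨ cong (map (suc i ,_) ∘ filter (suc i <?_)) (allFin-suc n) ⟩
  map (suc i ,_) (filter (suc i <?_) (map suc (allFin n)))
    ≡⟨ cong (map (suc i ,_)) (filter-suc<-map-suc i (allFin n)) ⟩
  map (suc i ,_) (map suc (filter (i <?_) (allFin n)))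
    ≡⟨ map-∘ _ ⟨
  map (λ j → suc i , suc j) (filter (i <?_) (allFin n))
    ≡⟨ map-∘ _ ⟩
  map (Product.map suc suc) (row n i) ∎
  where open ≡-Reasoning

edges-suc : ∀ n →
  edges (suc n) ≡ map (λ j → zero , suc j) (allFin n) ++ map (Product.map suc suc) (edges n)
edges-suc n = begin
  concatMap (row (suc n)) (allFin (suc n))
    ≡⟨ cong (concatMap (row (suc n))) (allFin-suc n) ⟩
  row (suc n) zero ++ concatMap (row (suc n)) (map suc (allFin n))
    ≡⟨ cong₂ _++_ (row-zero n) (concatMap-map (row (suc n)) suc (allFin n)) ⟩
  star ++ concatMap (row (suc n) ∘ suc) (allFin n)
    ≡⟨ cong (star ++_) (concatMap-cong (row-suc n) (allFin n)) ⟩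
  star ++ concatMap (map (Product.map suc suc) ∘ row n) (allFin n)
    ≡⟨ cong (star ++_) (map-concatMap _ (row n) (allFin n)) ⟨
  star ++ map (Product.map suc suc) (edges n) ∎
  where
  open ≡-Reasoning
  star = map (λ j → zero , suc j) (allFin n)

length-edges : ∀ n → length (edges n) ≡ choose2 n
length-edges zero    = refl
length-edges (suc n) = begin
  length (edges (suc n))
    ≡⟨ cong length (edges-suc n) ⟩
  length (star ++ map (Product.map suc suc) (edges n))
    ≡⟨ length-++ star ⟩
  length star ℕ.+ length (map (Product.map suc suc) (edges n))
    ≡⟨ cong₂ ℕ._+_ (trans (length-map _ (allFin n)) (length-tabulate id))
                   (trans (length-map _ (edges n)) (length-edges n)) ⟩
  n ℕ.+ choose2 n ∎
  where
  open ≡-Reasoning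
  star = map (λ j → zero , suc j) (allFin n)

cutVector-suc : ∀ {n} (x : Fin (suc n) → Bool) →
  cutVector x ≡ tabulate (λ j → x zero xor x (suc j)) ++ cutVector (x ∘ suc)
cutVector-suc {n} x = begin
  map cut (edges (suc n))
    ≡⟨ cong (map cut) (edges-suc n) ⟩
  map cut (map (λ j → zero , suc j) (allFin n) ++ map (Product.map suc suc) (edges n))
    ≡⟨ map-++ cut (map (λ j → zero , suc j) (allFin n)) _ ⟩
  map cut (map (λ j → zero , suc j) (allFin n)) ++ map cut (map (Product.map suc suc) (edges n))
    ≡⟨ cong₂ _++_ (trans (sym (map-∘ (allFin n))) (map-tabulate id _)) (sym (map-∘ (edges n))) ⟩
  tabulate (λ j → x zero xor x (suc j)) ++ cutVector (x ∘ suc) ∎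
  where
  open ≡-Reasoning
  cut : Fin (suc n) × Fin (suc n) → Bool
  cut e = x (proj₁ e) xor x (proj₂ e)

firstRow : ℕ → ℕ → List Bool
firstRow n k = tabulate {n = n} (λ j → not (toℕ j <ᵇ k))

isolatedCut-suc : ∀ n k → isolatedCut (suc n) (suc k) ≡ firstRow n k ++ isolatedCut n k
isolatedCut-suc n k = cutVector-suc (onesThenZeros (suc n) (suc k))

length-isolatedCut : ∀ n k → length (isolatedCut n k) ≡ choose2 n
length-isolatedCut n k = trans (length-map _ (edges n)) (length-edges n)

module UnimodalSequences {a ℓ₁ ℓ₂} (O : StrictTotalOrder a ℓ₁ ℓ₂) where
  open StrictTotalOrder O using (Carrier; _<_; compare; irrefl; strictPartialOrder; module Eq)
  open import Relation.Binary.Construct.StrictToNonStrict (StrictTotalOrder._≈_ O) _<_ using (_≤_; <⇒≤)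
  open import Relation.Binary.Reasoning.StrictPartialOrder strictPartialOrder

  DescentPersists : ℕ → (ℕ → Carrier) → Set (ℓ₁ ⊔ ℓ₂)
  DescentPersists N w = ∀ m → suc (suc m) ℕ.< N → w (suc m) ≤ w m → w (suc (suc m)) < w (suc m)

  module _ {N : ℕ} {w : ℕ → Carrier} (persists : DescentPersists N w) where

    keeps-falling : ∀ {k j} → w (suc k) ≤ w k → k ≤′ j → suc j ℕ.< N → w (suc j) ≤ w j
    keeps-falling fall ≤′-refl           _     = fall
    keeps-falling fall (≤′-step {j} k≤j) j+2<N =
      <⇒≤ (persists j j+2<N (keeps-falling fall k≤j (ℕ.<⇒≤ j+2<N)))

    ≤-start-of-fall : ∀ {k j} → w (suc k) ≤ w k → k ≤′ j → j ℕ.< N → w j ≤ w k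
    ≤-start-of-fall fall ≤′-refl           _     = begin w _ ∎
    ≤-start-of-fall fall (≤′-step {j} k≤j) j+1<N = begin
      w (suc j) ≤⟨ keeps-falling fall k≤j j+1<N ⟩
      w j       ≤⟨ ≤-start-of-fall fall k≤j (ℕ.<⇒≤ j+1<N) ⟩
      w _       ∎

    rising-before : ∀ {k j} → w k < w (suc k) → suc k ℕ.< N → j ≤′ k → w j < w (suc j)
    rising-before {k} {j} rise k+1<N j≤k = case compare (w j) (w (suc j)) of λ where
        (tri< up _ _)   → up
        (tri≈ _ flat _) → ⊥-elim (no-fall (inj₂ (Eq.sym flat)))
        (tri> _ _ down) → ⊥-elim (no-fall (<⇒≤ down))
      where
      no-fall : ¬ (w (suc j) ≤ w j)
      no-fall fall = irrefl Eq.refl (begin-strict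
        w k       <⟨ rise ⟩
        w (suc k) ≤⟨ keeps-falling fall j≤k k+1<N ⟩
        w k       ∎)

    nondecreasing-until-rise : ∀ {k j m} → w k < w (suc k) → suc k ℕ.< N →
      j ≤′ m → m ℕ.≤ suc k → w j ≤ w m
    nondecreasing-until-rise rise k+1<N ≤′-refl           _     = begin w _ ∎
    nondecreasing-until-rise rise k+1<N (≤′-step {m} j≤m) m<k+1 = begin
      w _       ≤⟨ nondecreasing-until-rise rise k+1<N j≤m (ℕ.<⇒≤ m<k+1) ⟩
      w m       <⟨ rising-before rise k+1<N (ℕ.≤⇒≤′ (ℕ.≤-pred m<k+1)) ⟩
      w (suc m) ∎

module OrderedFieldProperties (ℝ : RealField) where
  open RealField ℝ
  open IsCommutativeRing isCommutativeRing
    using (+-comm; +-assoc; *-comm; *-assoc; zeroʳ; +-identityˡ; +-identityʳ;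
           *-identityˡ; *-identityʳ; -‿inverseʳ)

  commutativeRing : CommutativeRing 0ℓ 0ℓ
  commutativeRing = record { isCommutativeRing = isCommutativeRing }

  strictTotalOrder : StrictTotalOrder 0ℓ 0ℓ 0ℓ
  strictTotalOrder = record { isStrictTotalOrder = isStrictTotalOrder }

  open StrictTotalOrder strictTotalOrder public using (compare; irrefl; asym) renaming (trans to <-trans)
  open import Relation.Binary.Construct.StrictToNonStrict _≡_ _<_ public using (<⇒≤; reflexive)
  open import Relation.Binary.Reasoning.StrictPartialOrder
    (StrictTotalOrder.strictPartialOrder strictTotalOrder) public
  open import Algebra.Properties.Ring (CommutativeRing.ring commutativeRing)
    using (-‿distribˡ-*; x[y-z]≈xy-xz; -‿involutive)

  <⇒≱ : ∀ {x y} → x < y → ¬ (y ≤ x)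
  <⇒≱ x<y (inj₁ y<x)  = asym x<y y<x
  <⇒≱ x<y (inj₂ refl) = irrefl refl x<y

  +-monoʳ-< : ∀ {x y} z → x < y → z + x < z + y
  +-monoʳ-< {x} {y} z x<y = subst₂ _<_ (+-comm x z) (+-comm y z) (+-mono-< z x<y)

  +-mono-≤-< : ∀ {x y u v} → x ≤ y → u < v → x + u < y + v
  +-mono-≤-< {x} {y} {u} (inj₁ x<y)  u<v = <-trans (+-mono-< u x<y) (+-monoʳ-< y u<v)
  +-mono-≤-< {x}         (inj₂ refl) u<v = +-monoʳ-< x u<v

  +-mono-≤ : ∀ {x y u v} → x ≤ y → u ≤ v → x + u ≤ y + v
  +-mono-≤ x≤y         (inj₁ u<v)  = <⇒≤ (+-mono-≤-< x≤y u<v)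
  +-mono-≤ (inj₁ x<y)  (inj₂ refl) = <⇒≤ (+-mono-< _ x<y)
  +-mono-≤ (inj₂ refl) (inj₂ refl) = reflexive refl

  +-cancelʳ-< : ∀ {x y} z → x + z < y + z → x < y
  +-cancelʳ-< {x} {y} z x+z<y+z = subst₂ _<_ (+-z x) (+-z y) (+-mono-< (- z) x+z<y+z)
    where
    +-z : ∀ u → u + z + - z ≡ u
    +-z u = trans (+-assoc u z (- z)) (trans (cong (u +_) (-‿inverseʳ z)) (+-identityʳ u))

  x<x+y : ∀ x {y} → 0# < y → x < x + y
  x<x+y x 0<y = subst (_< x + _) (+-identityʳ x) (+-monoʳ-< x 0<y)

  x<y+x : ∀ x {y} → 0# < y → x < y + x
  x<y+x x {y} 0<y = subst (x <_) (+-comm x y) (x<x+y x 0<y)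

  x<y⇒0<y-x : ∀ {x y} → x < y → 0# < y + - x
  x<y⇒0<y-x {x} {y} x<y = subst (_< y + - x) (-‿inverseʳ x) (+-mono-< (- x) x<y)

  0<y-x⇒x<y : ∀ {x y} → 0# < y + - x → x < y
  0<y-x⇒x<y {x} {y} 0<y-x = +-cancelʳ-< (- x) (subst (_< y + - x) (sym (-‿inverseʳ x)) 0<y-x)

  balance-< : ∀ {x y a b} → x + b ≡ y + a → b < a → y < x
  balance-< {x} {y} {a} {b} eq b<a = +-cancelʳ-< b (begin-strict
    y + b <⟨ +-monoʳ-< y b<a ⟩
    y + a ≡⟨ eq ⟨
    x + b ∎)

  balance-≤ : ∀ {x y a b} → x + b ≡ y + a → y ≤ x → b ≤ a
  balance-≤ {a = a} {b} eq y≤x with compare b a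
  ... | tri< b<a _ _ = <⇒≤ b<a
  ... | tri≈ _ b≡a _ = reflexive b≡a
  ... | tri> _ _ a<b = ⊥-elim (<⇒≱ (balance-< (sym eq) a<b) y≤x)

  *-monoˡ-< : ∀ {c x y} → 0# < c → x < y → c * x < c * y
  *-monoˡ-< {c} {x} {y} 0<c x<y =
    0<y-x⇒x<y (subst (0# <_) (x[y-z]≈xy-xz c y x) (*-pos 0<c (x<y⇒0<y-x x<y)))

  *-monoʳ-< : ∀ {c x y} → 0# < c → x < y → x * c < y * c
  *-monoʳ-< {c} {x} {y} 0<c x<y = subst₂ _<_ (*-comm c x) (*-comm c y) (*-monoˡ-< 0<c x<y)

  *-monoˡ-≤ : ∀ {c x y} → 0# < c → x ≤ y → c * x ≤ c * y
  *-monoˡ-≤ 0<c (inj₁ x<y)  = <⇒≤ (*-monoˡ-< 0<c x<y)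
  *-monoˡ-≤ 0<c (inj₂ refl) = reflexive refl

  *-monoʳ-≤ : ∀ {c x y} → 0# < c → x ≤ y → x * c ≤ y * c
  *-monoʳ-≤ 0<c (inj₁ x<y)  = <⇒≤ (*-monoʳ-< 0<c x<y)
  *-monoʳ-≤ 0<c (inj₂ refl) = reflexive refl

  *-cancelʳ-< : ∀ {c x y} → 0# < c → x * c < y * c → x < y
  *-cancelʳ-< {c} {x} {y} 0<c xc<yc with compare x y
  ... | tri< x<y _ _  = x<y
  ... | tri≈ _ refl _ = ⊥-elim (irrefl refl xc<yc)
  ... | tri> _ _ y<x  = ⊥-elim (asym xc<yc (*-monoʳ-< 0<c y<x))

  -- 0 = 1 would make the ring trivial, and 1 < 0 would make 1 = (-1)(-1) negative.
  0<1 : ∀ {x y} → x < y → 0# < 1#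
  0<1 {x} {y} x<y with compare 0# 1#
  ... | tri< 0<1 _ _ = 0<1
  ... | tri≈ _ 0≡1 _ = ⊥-elim (irrefl (trans (≡0 x) (sym (≡0 y))) x<y)
    where
    ≡0 : ∀ z → z ≡ 0#
    ≡0 z = trans (sym (*-identityʳ z)) (trans (cong (z *_) (sym 0≡1)) (zeroʳ z))
  ... | tri> _ _ 1<0 = ⊥-elim (asym 1<0 (subst (0# <_) -1*-1≡1 (*-pos 0<-1 0<-1)))
    where
    0<-1 : 0# < - 1#
    0<-1 = subst₂ _<_ (-‿inverseʳ 1#) (+-identityˡ (- 1#)) (+-mono-< (- 1#) 1<0)
    -1*-1≡1 : - 1# * - 1# ≡ 1#
    -1*-1≡1 = trans (sym (-‿distribˡ-* 1# (- 1#)))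
                    (trans (cong -_ (*-identityˡ (- 1#))) (-‿involutive 1#))

  ^-+ : ∀ x m n → x ^ (m ℕ.+ n) ≡ x ^ m * x ^ n
  ^-+ x zero    n = sym (*-identityˡ (x ^ n))
  ^-+ x (suc m) n = trans (cong (x *_) (^-+ x m n)) (sym (*-assoc x (x ^ m) (x ^ n)))

  ^-pos : ∀ {x} n → 0# < x → 0# < x ^ n
  ^-pos zero    0<x = 0<1 0<x
  ^-pos (suc n) 0<x = *-pos 0<x (^-pos n 0<x)

  ^-monoˡ-< : ∀ {x y} n → 0# < x → x < y → x ^ suc n < y ^ suc n
  ^-monoˡ-≤ : ∀ {x y} n → 0# < x → x < y → x ^ n ≤ y ^ n
  ^-monoˡ-< {x} {y} n 0<x x<y = begin-strict
    x * x ^ n ≤⟨ *-monoˡ-≤ 0<x (^-monoˡ-≤ n 0<x x<y) ⟩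
    x * y ^ n <⟨ *-monoʳ-< (^-pos n (<-trans 0<x x<y)) x<y ⟩
    y * y ^ n ∎
  ^-monoˡ-≤ zero    _   _   = reflexive refl
  ^-monoˡ-≤ (suc n) 0<x x<y = <⇒≤ (^-monoˡ-< n 0<x x<y)

  x≤x^n : ∀ {x n} → 1# < x → 0 ℕ.< n → x ≤ x ^ n
  1≤x^n : ∀ {x} n → 1# < x → 1# ≤ x ^ n
  x≤x^n {x} {suc n} 1<x _ =
    subst (_≤ x * x ^ n) (*-identityʳ x) (*-monoˡ-≤ (<-trans (0<1 1<x) 1<x) (1≤x^n n 1<x))
  1≤x^n         zero    _   = reflexive refl
  1≤x^n {x} (suc n) 1<x = <⇒≤ (begin-strict
    1#        <⟨ 1<x ⟩
    x         ≤⟨ x≤x^n {n = suc n} 1<x ℕ.z<s ⟩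
    x * x ^ n ∎)

module PowerRatios (ℝ : RealField) where
  open RealField ℝ
  open OrderedFieldProperties ℝ
  open IsCommutativeRing isCommutativeRing using (*-comm; *-assoc; distribʳ; zeroˡ; +-identityʳ)
  open import Algebra.Solver.Ring.NaturalCoefficients.Default
    (CommutativeRing.commutativeSemiring commutativeRing)

  -- F x / x ^ M is nondecreasing, resp. decreasing, on x > 0, stated without division.
  RatioNondecreasing RatioDecreasing : ℕ → (Carrier → Carrier) → Set
  RatioNondecreasing M F = ∀ {ρ r} → 0# < ρ → ρ < r → F ρ * r ^ M ≤ F r * ρ ^ M
  RatioDecreasing    M F = ∀ {ρ r} → 0# < ρ → ρ < r → F r * ρ ^ M < F ρ * r ^ M

  private
    ^-split : ∀ x y s e → x ^ (s ℕ.+ e) * y ^ e ≡ x ^ s * (x ^ e * y ^ e)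
    ^-split x y s e = trans (cong (_* y ^ e) (^-+ x s e)) (*-assoc _ _ _)

    ^-shift : ∀ x y c M f → (x ^ c * f) * y ^ (c ℕ.+ M) ≡ (x ^ c * y ^ c) * (f * y ^ M)
    ^-shift x y c M f = trans (cong ((x ^ c * f) *_) (^-+ y c M))
      (solve 4 (λ a b c d → (a :* b) :* (c :* d) := (a :* c) :* (b :* d)) refl (x ^ c) f (y ^ c) (y ^ M))

  ^-ratioNondecreasing : ∀ {M e} → M ℕ.≤ e → RatioNondecreasing M (_^ e)
  ^-ratioNondecreasing {M} {e} M≤e {ρ} {r} 0<ρ ρ<r =
    subst (λ e → ρ ^ e * r ^ M ≤ r ^ e * ρ ^ M) (ℕ.m∸n+n≡m M≤e) (begin
      ρ ^ (d ℕ.+ M) * r ^ M   ≡⟨ ^-split ρ r d M ⟩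
      ρ ^ d * (ρ ^ M * r ^ M) ≤⟨ *-monoʳ-≤ (*-pos (^-pos M 0<ρ) (^-pos M (<-trans 0<ρ ρ<r)))
                                            (^-monoˡ-≤ d 0<ρ ρ<r) ⟩
      r ^ d * (ρ ^ M * r ^ M) ≡⟨ cong (r ^ d *_) (*-comm _ _) ⟩
      r ^ d * (r ^ M * ρ ^ M) ≡⟨ ^-split r ρ d M ⟨
      r ^ (d ℕ.+ M) * ρ ^ M   ∎)
    where d = e ∸ M

  ^-ratioDecreasing : ∀ {M e} → e ℕ.< M → RatioDecreasing M (_^ e)
  ^-ratioDecreasing {M} {e} e<M {ρ} {r} 0<ρ ρ<r =
    subst (λ M → r ^ e * ρ ^ M < ρ ^ e * r ^ M)
          (trans (sym (ℕ.+-suc d e)) (ℕ.m∸n+n≡m e<M)) (begin-strict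
      r ^ e * ρ ^ (suc d ℕ.+ e)   ≡⟨ *-comm _ _ ⟩
      ρ ^ (suc d ℕ.+ e) * r ^ e   ≡⟨ ^-split ρ r (suc d) e ⟩
      ρ ^ suc d * (ρ ^ e * r ^ e) <⟨ *-monoʳ-< (*-pos (^-pos e 0<ρ) (^-pos e (<-trans 0<ρ ρ<r)))
                                                (^-monoˡ-< d 0<ρ ρ<r) ⟩
      r ^ suc d * (ρ ^ e * r ^ e) ≡⟨ cong (r ^ suc d *_) (*-comm _ _) ⟩
      r ^ suc d * (r ^ e * ρ ^ e) ≡⟨ ^-split r ρ (suc d) e ⟨
      r ^ (suc d ℕ.+ e) * ρ ^ e   ≡⟨ *-comm _ _ ⟩
      ρ ^ e * r ^ (suc d ℕ.+ e)   ∎)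
    where d = M ∸ suc e

  ratioNondecreasing-0 : ∀ {M} → RatioNondecreasing M (λ _ → 0#)
  ratioNondecreasing-0 _ _ = reflexive (trans (zeroˡ _) (sym (zeroˡ _)))

  ratioNondecreasing-+ : ∀ {M F H} → RatioNondecreasing M F → RatioNondecreasing M H →
    RatioNondecreasing M (λ x → F x + H x)
  ratioNondecreasing-+ F↑ H↑ 0<ρ ρ<r =
    subst₂ _≤_ (sym (distribʳ _ _ _)) (sym (distribʳ _ _ _)) (+-mono-≤ (F↑ 0<ρ ρ<r) (H↑ 0<ρ ρ<r))

  ratioDecreasing-+ : ∀ {M F H} → RatioDecreasing M F → RatioDecreasing M H →
    RatioDecreasing M (λ x → F x + H x)
  ratioDecreasing-+ F↓ H↓ 0<ρ ρ<r =
    subst₂ _<_ (sym (distribʳ _ _ _)) (sym (distribʳ _ _ _))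
      (+-mono-≤-< (<⇒≤ (F↓ 0<ρ ρ<r)) (H↓ 0<ρ ρ<r))

  ratioNondecreasing-*^ : ∀ {M F} c → RatioNondecreasing M F →
    RatioNondecreasing (c ℕ.+ M) (λ x → x ^ c * F x)
  ratioNondecreasing-*^ {M} {F} c F↑ {ρ} {r} 0<ρ ρ<r = begin
    (ρ ^ c * F ρ) * r ^ (c ℕ.+ M)   ≡⟨ ^-shift ρ r c M (F ρ) ⟩
    (ρ ^ c * r ^ c) * (F ρ * r ^ M) ≤⟨ *-monoˡ-≤ (*-pos (^-pos c 0<ρ) (^-pos c (<-trans 0<ρ ρ<r)))
                                                (F↑ 0<ρ ρ<r) ⟩
    (ρ ^ c * r ^ c) * (F r * ρ ^ M) ≡⟨ cong (_* (F r * ρ ^ M)) (*-comm _ _) ⟩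
    (r ^ c * ρ ^ c) * (F r * ρ ^ M) ≡⟨ ^-shift r ρ c M (F r) ⟨
    (r ^ c * F r) * ρ ^ (c ℕ.+ M)   ∎

  ratioDecreasing-*^ : ∀ {M F} c → RatioDecreasing M F →
    RatioDecreasing (c ℕ.+ M) (λ x → x ^ c * F x)
  ratioDecreasing-*^ {M} {F} c F↓ {ρ} {r} 0<ρ ρ<r = begin-strict
    (r ^ c * F r) * ρ ^ (c ℕ.+ M)   ≡⟨ ^-shift r ρ c M (F r) ⟩
    (r ^ c * ρ ^ c) * (F r * ρ ^ M) <⟨ *-monoˡ-< (*-pos (^-pos c (<-trans 0<ρ ρ<r)) (^-pos c 0<ρ))
                                                (F↓ 0<ρ ρ<r) ⟩
    (r ^ c * ρ ^ c) * (F ρ * r ^ M) ≡⟨ cong (_* (F ρ * r ^ M)) (*-comm _ _) ⟩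
    (ρ ^ c * r ^ c) * (F ρ * r ^ M) ≡⟨ ^-shift ρ r c M (F ρ) ⟨
    (ρ ^ c * F ρ) * r ^ (c ℕ.+ M)   ∎

  crossing-right : ∀ {M F H ρ r} → RatioNondecreasing M F → RatioDecreasing M H →
    0# < ρ → F ρ ≡ H ρ → ρ < r → H r < F r
  crossing-right {M} {F} {H} {ρ} {r} F↑ H↓ 0<ρ Fρ≡Hρ ρ<r = *-cancelʳ-< (^-pos M 0<ρ) (begin-strict
    H r * ρ ^ M <⟨ H↓ 0<ρ ρ<r ⟩
    H ρ * r ^ M ≡⟨ cong (_* r ^ M) Fρ≡Hρ ⟨
    F ρ * r ^ M ≤⟨ F↑ 0<ρ ρ<r ⟩
    F r * ρ ^ M ∎)

  crossing-left : ∀ {M F H ρ r} → RatioNondecreasing M F → RatioDecreasing M H →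
    0# < r → F ρ ≡ H ρ → r < ρ → F r < H r
  crossing-left {M} {F} {H} {ρ} {r} F↑ H↓ 0<r Fρ≡Hρ r<ρ =
    *-cancelʳ-< (^-pos M (<-trans 0<r r<ρ)) (begin-strict
    F r * ρ ^ M ≤⟨ F↑ 0<r r<ρ ⟩
    F ρ * r ^ M ≡⟨ cong (_* r ^ M) Fρ≡Hρ ⟩
    H ρ * r ^ M <⟨ H↓ 0<r r<ρ ⟩
    H r * ρ ^ M ∎)

  geomSum : ℕ → Carrier → Carrier
  geomSum zero    x = 0#
  geomSum (suc a) x = x ^ a + geomSum a x

  geomSum-pos : ∀ {a x} → 0 ℕ.< a → 0# < x → 0# < geomSum a x
  geomSum-pos {suc zero}        _ 0<x = subst (0# <_) (sym (+-identityʳ _)) (^-pos 0 0<x)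
  geomSum-pos {suc (suc a)} {x} _ 0<x = begin-strict
    0#                            <⟨ geomSum-pos {suc a} ℕ.z<s 0<x ⟩
    geomSum (suc a) x             <⟨ x<y+x _ (^-pos (suc a) 0<x) ⟩
    x ^ suc a + geomSum (suc a) x ∎

  geomSum-ratioDecreasing : ∀ {a M} → 0 ℕ.< a → a ℕ.≤ M → RatioDecreasing M (geomSum a)
  geomSum-ratioDecreasing {suc zero}    {M} _ 1≤M {ρ} {r} 0<ρ ρ<r =
    subst₂ _<_ (cong (_* ρ ^ M) (sym (+-identityʳ _))) (cong (_* r ^ M) (sym (+-identityʳ _)))
      (^-ratioDecreasing 1≤M 0<ρ ρ<r)
  geomSum-ratioDecreasing {suc (suc a)} {M} _ a+2≤M =
    ratioDecreasing-+ {M} (^-ratioDecreasing a+2≤M) (geomSum-ratioDecreasing ℕ.z<s (ℕ.<⇒≤ a+2≤M))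

module IsolatedCutWeights (ℝ : RealField) where
  open RealField ℝ
  open OrderedFieldProperties ℝ
  open PowerRatios ℝ
  open UnimodalSequences strictTotalOrder
  open IsCommutativeRing isCommutativeRing using (+-assoc; zeroˡ; +-identityˡ; +-identityʳ; *-identityˡ)
  open import Algebra.Properties.Ring (CommutativeRing.ring commutativeRing)
    using (x∙y⁻¹≈ε⇒x≈y; +-cancelˡ)
  open import Algebra.Solver.Ring.NaturalCoefficients.Default
    (CommutativeRing.commutativeSemiring commutativeRing)

  -- Σ_{i<k} x ^ choose2 (n-1-i): row i of K_n is followed by choose2 (n-1-i) edges.
  rowSum : ℕ → ℕ → Carrier → Carrier
  rowSum n       zero    x = 0#
  rowSum zero    (suc k) x = 0#
  rowSum (suc n) (suc k) x = x ^ choose2 n + rowSum n k x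

  rowSum-snoc : ∀ {n k} x → k ℕ.< n → rowSum n (suc k) x ≡ rowSum n k x + x ^ choose2 (n ∸ suc k)
  rowSum-snoc {suc n} {zero}  x _         = trans (+-identityʳ _) (sym (+-identityˡ _))
  rowSum-snoc {suc n} {suc k} x (s≤s k<n) =
    trans (cong (x ^ choose2 n +_) (rowSum-snoc x k<n)) (sym (+-assoc _ _ _))

  rowSum-ratioNondecreasing : ∀ n k {L} → L ℕ.≤ choose2 (n ∸ k) → RatioNondecreasing L (rowSum n k)
  rowSum-ratioNondecreasing n       zero    {L} _  = ratioNondecreasing-0 {L}
  rowSum-ratioNondecreasing zero    (suc k) {L} _  = ratioNondecreasing-0 {L}
  rowSum-ratioNondecreasing (suc n) (suc k) {L} L≤ = ratioNondecreasing-+ {L}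
    (^-ratioNondecreasing (ℕ.≤-trans L≤ (choose2-mono (ℕ.m∸n≤m n k))))
    (rowSum-ratioNondecreasing n k L≤)

  W-++ : ∀ xs ys r → W ℝ (xs ++ ys) r ≡ W ℝ xs r * r ^ length ys + W ℝ ys r
  W-++ []       ys r = sym (trans (cong (_+ W ℝ ys r) (zeroˡ _)) (+-identityˡ _))
  W-++ (b ∷ xs) ys r = begin-equality
    bit ℝ b * r ^ length (xs ++ ys) + W ℝ (xs ++ ys) r
      ≡⟨ cong₂ (λ p w → bit ℝ b * p + w)
           (trans (cong (r ^_) (length-++ xs)) (^-+ r (length xs) (length ys))) (W-++ xs ys r) ⟩
    bit ℝ b * (r ^ length xs * r ^ length ys) + (W ℝ xs r * r ^ length ys + W ℝ ys r)
      ≡⟨ solve 5 (λ b p q w v → b :* (p :* q) :+ (w :* q :+ v) := (b :* p :+ w) :* q :+ v)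
           refl (bit ℝ b) (r ^ length xs) (r ^ length ys) (W ℝ xs r) (W ℝ ys r) ⟩
    (bit ℝ b * r ^ length xs + W ℝ xs r) * r ^ length ys + W ℝ ys r ∎

  W-map-false : ∀ {A : Set} (xs : List A) r → W ℝ (map (λ _ → false) xs) r ≡ 0#
  W-map-false []       r = refl
  W-map-false (_ ∷ xs) r = trans (cong₂ _+_ (zeroˡ _) (W-map-false xs r)) (+-identityˡ 0#)

  W-firstRow : ∀ n k r → W ℝ (firstRow n k) r ≡ geomSum (n ∸ k) r
  W-firstRow zero    zero    r = refl
  W-firstRow zero    (suc k) r = refl
  W-firstRow (suc n) zero    r = cong₂ _+_
    (trans (*-identityˡ _) (cong (r ^_) (length-tabulate {n = n} (λ _ → true)))) (W-firstRow n zero r)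
  W-firstRow (suc n) (suc k) r =
    trans (cong (_+ W ℝ (firstRow n k) r) (zeroˡ _)) (trans (+-identityˡ _) (W-firstRow n k r))

  W-isolatedCut : ∀ n k r → W ℝ (isolatedCut n k) r ≡ rowSum n k r * geomSum (n ∸ k) r
  W-isolatedCut n       zero    r = trans (W-map-false (edges n) r) (sym (zeroˡ _))
  W-isolatedCut zero    (suc k) r = sym (zeroˡ _)
  W-isolatedCut (suc n) (suc k) r = begin-equality
    W ℝ (isolatedCut (suc n) (suc k)) r
      ≡⟨ cong (λ δ → W ℝ δ r) (isolatedCut-suc n k) ⟩
    W ℝ (firstRow n k ++ isolatedCut n k) r
      ≡⟨ W-++ (firstRow n k) (isolatedCut n k) r ⟩
    W ℝ (firstRow n k) r * r ^ length (isolatedCut n k) + W ℝ (isolatedCut n k) r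
      ≡⟨ cong₂ _+_ (cong₂ _*_ (W-firstRow n k r) (cong (r ^_) (length-isolatedCut n k)))
                   (W-isolatedCut n k r) ⟩
    g * r ^ choose2 n + rowSum n k r * g
      ≡⟨ solve 3 (λ g p s → g :* p :+ s :* g := (p :+ s) :* g) refl g (r ^ choose2 n) (rowSum n k r) ⟩
    (r ^ choose2 n + rowSum n k r) * g ∎
    where g = geomSum (n ∸ k) r

  P⁺ P⁻ : ℕ → ℕ → Carrier → Carrier
  P⁺ n k x = x ^ (n ∸ suc k) * rowSum n k x
  P⁻ n k x = x ^ choose2 (n ∸ suc k) * geomSum (n ∸ suc k) x

  W-isolatedCut-parts : ∀ {n k} x → k ℕ.< n →
    W ℝ (isolatedCut n k) x + P⁻ n k x ≡ W ℝ (isolatedCut n (suc k)) x + P⁺ n k x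
  W-isolatedCut-parts {n} {k} x k<n = begin-equality
    W ℝ (isolatedCut n k) x + q * g
      ≡⟨ cong (_+ q * g) (trans (W-isolatedCut n k x)
                                (cong (λ m → s * geomSum m x) (m∸n≡1+[m∸1+n] k<n))) ⟩
    s * (p + g) + q * g
      ≡⟨ solve 4 (λ s p g q → s :* (p :+ g) :+ q :* g := (s :+ q) :* g :+ p :* s) refl s p g q ⟩
    (s + q) * g + p * s
      ≡⟨ cong (λ t → t * g + p * s) (rowSum-snoc x k<n) ⟨
    rowSum n (suc k) x * g + p * s
      ≡⟨ cong (_+ p * s) (W-isolatedCut n (suc k) x) ⟨
    W ℝ (isolatedCut n (suc k)) x + p * s ∎
    where
    a = n ∸ suc k
    s = rowSum n k x
    p = x ^ a
    q = x ^ choose2 a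
    g = geomSum a x

  P≡0⇒P⁺≡P⁻ : ∀ {n k ρ} → k ℕ.< n → P ℝ n k ρ ≡ 0# → P⁺ n k ρ ≡ P⁻ n k ρ
  P≡0⇒P⁺≡P⁻ {n} {k} {ρ} k<n P≡0 = sym (+-cancelˡ (W ℝ (isolatedCut n k) ρ) _ _ (begin-equality
    W ℝ (isolatedCut n k) ρ + P⁻ n k ρ       ≡⟨ W-isolatedCut-parts ρ k<n ⟩
    W ℝ (isolatedCut n (suc k)) ρ + P⁺ n k ρ ≡⟨ cong (_+ P⁺ n k ρ) (x∙y⁻¹≈ε⇒x≈y _ _ P≡0) ⟨
    W ℝ (isolatedCut n k) ρ + P⁺ n k ρ       ∎))

  P⁺-ratioNondecreasing : ∀ {n k} → k ℕ.< n → RatioNondecreasing (choose2 (suc (n ∸ suc k))) (P⁺ n k)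
  P⁺-ratioNondecreasing {n} {k} k<n = ratioNondecreasing-*^ a (rowSum-ratioNondecreasing n k
    (subst (λ m → choose2 a ℕ.≤ choose2 m) (sym (m∸n≡1+[m∸1+n] k<n)) (ℕ.m≤n+m (choose2 a) a)))
    where a = n ∸ suc k

  P⁻-ratioDecreasing : ∀ {n k} → suc k ℕ.< n → RatioDecreasing (choose2 (suc (n ∸ suc k))) (P⁻ n k)
  P⁻-ratioDecreasing {n} {k} k+1<n = subst (λ M → RatioDecreasing M (P⁻ n k)) (ℕ.+-comm (choose2 a) a)
    (ratioDecreasing-*^ (choose2 a) (geomSum-ratioDecreasing (ℕ.m<n⇒0<n∸m k+1<n) ℕ.≤-refl))
    where a = n ∸ suc k

  lighter-right-of-root : ∀ {n k ρ r} → suc k ℕ.< n → 0# < ρ → P ℝ n k ρ ≡ 0# → ρ < r →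
    W ℝ (isolatedCut n (suc k)) r < W ℝ (isolatedCut n k) r
  lighter-right-of-root {n} {k} {r = r} k+1<n 0<ρ P≡0 ρ<r =
    balance-< (W-isolatedCut-parts r k<n)
      (crossing-right {choose2 (suc (n ∸ suc k))} {P⁺ n k} {P⁻ n k}
        (P⁺-ratioNondecreasing k<n) (P⁻-ratioDecreasing k+1<n) 0<ρ (P≡0⇒P⁺≡P⁻ k<n P≡0) ρ<r)
    where k<n = ℕ.<⇒≤ k+1<n

  heavier-left-of-root : ∀ {n k ρ r} → suc k ℕ.< n → 0# < r → P ℝ n k ρ ≡ 0# → r < ρ →
    W ℝ (isolatedCut n k) r < W ℝ (isolatedCut n (suc k)) r
  heavier-left-of-root {n} {k} {r = r} k+1<n 0<r P≡0 r<ρ =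
    balance-< (sym (W-isolatedCut-parts r k<n))
      (crossing-left {choose2 (suc (n ∸ suc k))} {P⁺ n k} {P⁻ n k}
        (P⁺-ratioNondecreasing k<n) (P⁻-ratioDecreasing k+1<n) 0<r (P≡0⇒P⁺≡P⁻ k<n P≡0) r<ρ)
    where k<n = ℕ.<⇒≤ k+1<n

  descent-inequality : ∀ {r p q g X} → 0# < r → r ≤ p → 0# < q → 0# < g →
    (p * q) * (p + g) ≤ (r * p) * X → q * g < p * (X + p * q)
  descent-inequality {r} {p} {q} {g} {X} 0<r r≤p 0<q 0<g hyp = *-cancelʳ-< 0<r (begin-strict
    (q * g) * r                     ≤⟨ *-monoˡ-≤ (*-pos 0<q 0<g) r≤p ⟩
    (q * g) * p                     <⟨ x<y+x _ (*-pos (*-pos 0<p 0<p) 0<q) ⟩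
    (p * p) * q + (q * g) * p       ≡⟨ solve 3 (λ p q g → (p :* p) :* q :+ (q :* g) :* p := (p :* q) :* (p :+ g))
                                               refl p q g ⟩
    (p * q) * (p + g)               ≤⟨ hyp ⟩
    (r * p) * X                     <⟨ x<x+y _ (*-pos (*-pos 0<p (*-pos 0<p 0<q)) 0<r) ⟩
    (r * p) * X + (p * (p * q)) * r ≡⟨ solve 4 (λ r p q X → (r :* p) :* X :+ (p :* (p :* q)) :* r
                                                          := (p :* (X :+ p :* q)) :* r) refl r p q X ⟩
    (p * (X + p * q)) * r           ∎)
    where
    0<p : 0# < p
    0<p = begin-strict 0# <⟨ 0<r ⟩ r ≤⟨ r≤p ⟩ p ∎

  P⁻≤P⁺⇒P⁻<P⁺ : ∀ {n k r} → 1# < r → suc (suc k) ℕ.< n →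
    P⁻ n k r ≤ P⁺ n k r → P⁻ n (suc k) r < P⁺ n (suc k) r
  P⁻≤P⁺⇒P⁻<P⁺ {n} {k} {r} 1<r k+2<n P⁻≤P⁺ =
    subst (q * g <_) (sym P⁺-next)
      (descent-inequality 0<r (x≤x^n 1<r 0<b) (^-pos (choose2 b) 0<r) (geomSum-pos 0<b 0<r)
        (subst₂ _≤_ P⁻-this P⁺-this P⁻≤P⁺))
    where
    0<r = <-trans (0<1 1<r) 1<r
    b = n ∸ suc (suc k)
    0<b : 0 ℕ.< b
    0<b = ℕ.m<n⇒0<n∸m k+2<n
    p = r ^ b
    q = r ^ choose2 b
    g = geomSum b r
    X = rowSum n k r
    a≡1+b : n ∸ suc k ≡ suc b
    a≡1+b = m∸n≡1+[m∸1+n] (ℕ.<⇒≤ k+2<n)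
    P⁻-this : P⁻ n k r ≡ (p * q) * (p + g)
    P⁻-this = trans (cong (λ a → r ^ choose2 a * geomSum a r) a≡1+b)
                    (cong (_* (p + g)) (^-+ r b (choose2 b)))
    P⁺-this : P⁺ n k r ≡ (r * p) * X
    P⁺-this = cong (λ a → r ^ a * X) a≡1+b
    P⁺-next : P⁺ n (suc k) r ≡ p * (X + p * q)
    P⁺-next = cong (p *_) (trans (rowSum-snoc r (ℕ.<⇒≤ (ℕ.<⇒≤ k+2<n)))
      (cong (X +_) (trans (cong (λ a → r ^ choose2 a) a≡1+b) (^-+ r b (choose2 b)))))

  isolatedCut-descentPersists : ∀ {n r} → 1# < r → DescentPersists n (λ m → W ℝ (isolatedCut n m) r)
  isolatedCut-descentPersists {n} {r} 1<r m m+2<n fall =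
    balance-< (W-isolatedCut-parts r (ℕ.<⇒≤ m+2<n))
      (P⁻≤P⁺⇒P⁻<P⁺ 1<r m+2<n (balance-≤ (W-isolatedCut-parts r (ℕ.<⇒≤ (ℕ.<⇒≤ m+2<n))) fall))

  threshold-≥1 : ∀ {n k ρ} → IsThreshold ℝ n (suc k) ρ → 1# ≤ ρ
  threshold-≥1 {n} {k} th with suc k ℕ.≟ n / 2
  ... | yes _ = reflexive (sym th)
  ... | no  _ = <⇒≤ (proj₁ (proj₂ th))

  threshold<⇒1< : ∀ {n k ρ r} → IsThreshold ℝ n (suc k) ρ → ρ < r → 1# < r
  threshold<⇒1< {ρ = ρ} {r} th ρ<r = begin-strict 1# ≤⟨ threshold-≥1 th ⟩ ρ <⟨ ρ<r ⟩ r ∎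

  threshold-root : ∀ {n k ρ} → suc k ℕ.< n / 2 → IsThreshold ℝ n (suc k) ρ → P ℝ n (suc k) ρ ≡ 0#
  threshold-root {n} {k} k+1<n/2 th with suc k ℕ.≟ n / 2
  ... | yes k+1≡n/2 = ⊥-elim (ℕ.<-irrefl k+1≡n/2 k+1<n/2)
  ... | no  _       = proj₁ th

  dominates-above : ∀ {n k j lo r} → 1# < r → IsThreshold ℝ n (suc k) lo → lo < r →
    suc k ≤′ j → j ℕ.≤ n / 2 → W ℝ (isolatedCut n j) r ≤ W ℝ (isolatedCut n (suc k)) r
  dominates-above _ _ _ ≤′-refl _ = reflexive refl
  dominates-above {n} {k} {lo = lo} 1<r th lo<r (≤′-step k+1≤j) j+1≤n/2 =
    ≤-start-of-fall (isolatedCut-descentPersists {n} 1<r)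
      (<⇒≤ (lighter-right-of-root {n} (m≤n/2⇒m<n ℕ.z<s k+2≤n/2) 0<lo (threshold-root k+2≤n/2 th) lo<r))
      (≤′-step k+1≤j) (m≤n/2⇒m<n ℕ.z<s j+1≤n/2)
    where
    k+2≤n/2 : suc (suc k) ℕ.≤ n / 2
    k+2≤n/2 = ℕ.≤-trans (s≤s (ℕ.≤′⇒≤ k+1≤j)) j+1≤n/2
    0<lo : 0# < lo
    0<lo = begin-strict 0# <⟨ 0<1 1<r ⟩ 1# ≤⟨ threshold-≥1 th ⟩ lo ∎

  dominates-below : ∀ {n k j hi r} → 1# < r → IsThreshold ℝ n k hi → r < hi →
    0 ℕ.< j → j ≤′ suc k → suc k ℕ.≤ n / 2 →
    W ℝ (isolatedCut n j) r ≤ W ℝ (isolatedCut n (suc k)) r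
  dominates-below _ _ _ _  ≤′-refl _ = reflexive refl
  dominates-below {k = zero} _ _ _ () (≤′-step ≤′-refl) _
  dominates-below {n} {suc k} 1<r th r<hi _ (≤′-step j≤k+1) k+2≤n/2 =
    nondecreasing-until-rise (isolatedCut-descentPersists {n} 1<r)
      (heavier-left-of-root {n} k+2<n (<-trans (0<1 1<r) 1<r) (threshold-root k+2≤n/2 th) r<hi)
      k+2<n (≤′-step j≤k+1) ℕ.≤-refl
    where
    k+2<n : suc (suc k) ℕ.< n
    k+2<n = m≤n/2⇒m<n ℕ.z<s k+2≤n/2

open import Data.Nat using (_≤_)

mainTheorem1 : (ℝ : RealField) → (n k : ℕ) → 6 ≤ n → 1 ≤ k → k ≤ n / 2 →
    (lo hi r : RealField.Carrier ℝ) →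
    IsThreshold ℝ n k lo → IsThreshold ℝ n (k ∸ 1) hi →
    RealField._<_ ℝ lo r → RealField._<_ ℝ r hi →
    (j : ℕ) → 1 ≤ j → j ≤ n / 2 →
    RealField._≤_ ℝ (W ℝ (isolatedCut n j) r) (W ℝ (isolatedCut n k) r)
mainTheorem1 ℝ n (suc k) _ _ k+1≤n/2 lo hi r thLo thHi lo<r r<hi j 0<j j≤n/2 =
  [ (λ j≤k+1 → dominates-below 1<r thHi r<hi 0<j (ℕ.≤⇒≤′ j≤k+1) k+1≤n/2)
  , (λ k+1≤j → dominates-above 1<r thLo lo<r (ℕ.≤⇒≤′ k+1≤j) j≤n/2)
  ]′ (ℕ.≤-total j (suc k))
  where
  open IsolatedCutWeights ℝ
  1<r = threshold<⇒1< thLo lo<r
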